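{- Let $k \ge 2$. For every integer $n$, $$|S_n(123,\ 132,\ (k-1)(k-2)\ldots 1\,k)| = F_{k-1,n+1}.$$ Moreover, the generating function $f(x) = \sum_{n=0}^\infty |S_n(123, 132, (k-1)(k-2)\ldots 1\, k)|\, x^n$ is given by $$f(x) = \frac{1}{1 - x - x^2 - \cdots - x^{k-1}}.$$
   Context: Permutations of $[n]=\{1,\dots,n\}$ are written in one-line notation, and $S_n$ denotes the set of them. A permutation $\pi\in S_n$ contains $\sigma\in S_m$ if there are indices $i_1<\dots<i_m$ such that for all $a,b$, $\pi(i_a)<\pi(i_b)$ iff $\sigma(a)<\sigma(b)$; otherwise $\pi$ avoids $\sigma$. For a set $R$ of permutations, $S_n(R)$ is the set of $\pi\in S_n$ avoiding every element of $R$. By convention $S_0(R)$ consists of the empty permutation only, and $S_n(R)=\emptyset$ for $n<0$. The permutation $(k-1)(k-2)\ldots 1\,k \in S_k$ lists $k-1,k-2,\dots,1$ in decreasing order followed by $k$. For $k\ge 1$ the $k$-generalized Fibonacci numbers are defined by $F_{k,n}=0$ for $n\le 0$, $F_{k,1}=1$, and $F_{k,n}=\sum_{i=1}^k F_{k,n-i}$ for $n\ge 2$. -}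

module Defs where

open import Data.Bool using (Bool; true; false; _∧_; _∨_; not; if_then_else_)
open import Data.Nat using (ℕ; zero; suc; _+_; _∸_; _<ᵇ_; _≡ᵇ_)
open import Data.List using (List; []; _∷_; _++_; map; concatMap; length; take;
  filterᵇ; zip; upTo; downFrom; [_])
open import Data.Integer using (ℤ; +_; -[1+_]) renaming (_+_ to _+ℤ_; _*_ to _*ℤ_)
open import Data.Bool.ListAction using (any; all)
open import Data.Nat.ListAction using (sum)
open import Data.Product using (_×_; proj₁; proj₂)

words : ∀ {A : Set} → List A → ℕ → List (List A)
words xs zero = [] ∷ []
words xs (suc m) = concatMap (λ x → map (x ∷_) (words xs m)) xs

oneTo : ℕ → List ℕ
oneTo n = map suc (upTo n)

elemᵇ : ℕ → List ℕ → Bool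
elemᵇ x = any (λ y → x ≡ᵇ y)

distinct : List ℕ → Bool
distinct [] = true
distinct (x ∷ xs) = not (elemᵇ x xs) ∧ distinct xs

Sn : ℕ → List (List ℕ)
Sn n = filterᵇ distinct (words (oneTo n) n)

subseqs : ∀ {A : Set} → List A → List (List A)
subseqs [] = [] ∷ []
subseqs (x ∷ xs) = map (x ∷_) (subseqs xs) ++ subseqs xs

_⇔ᵇ_ : Bool → Bool → Bool
true ⇔ᵇ b = b
false ⇔ᵇ b = not b

sameLength : List ℕ → List ℕ → Bool
sameLength [] [] = true
sameLength (_ ∷ xs) (_ ∷ ys) = sameLength xs ys
sameLength _ _ = false

orderIsoᵇ : List ℕ → List ℕ → Bool
orderIsoᵇ xs ys = sameLength xs ys ∧
  all (λ p → all (λ q → (proj₁ p <ᵇ proj₁ q) ⇔ᵇ (proj₂ p <ᵇ proj₂ q)) zs) zs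
  where zs = zip xs ys

containsᵇ : List ℕ → List ℕ → Bool
containsᵇ π σ = any (λ s → orderIsoᵇ s σ) (subseqs π)

avoidsAllᵇ : List (List ℕ) → List ℕ → Bool
avoidsAllᵇ R π = all (λ σ → not (containsᵇ π σ)) R

countAvoiders : List (List ℕ) → ℤ → ℕ
countAvoiders R (+ n) = length (filterᵇ (avoidsAllᵇ R) (Sn n))
countAvoiders R -[1+ _ ] = 0

decThenMax : ℕ → List ℕ
decThenMax k = map suc (downFrom (k ∸ 1)) ++ [ k ]

-- fibTable k n = [F_{k,n}, F_{k,n-1}, …, F_{k,0}]
fibTable : ℕ → ℕ → List ℕ
fibTable k zero = 0 ∷ []
fibTable k (suc zero) = 1 ∷ 0 ∷ []
fibTable k (suc (suc n)) = sum (take k (fibTable k (suc n))) ∷ fibTable k (suc n)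

headOr0 : List ℕ → ℕ
headOr0 [] = 0
headOr0 (x ∷ _) = x

F : ℕ → ℤ → ℕ
F k (+ n) = headOr0 (fibTable k n)
F k -[1+ _ ] = 0

Series : Set
Series = ℕ → ℤ

convAux : Series → Series → ℕ → ℕ → ℤ
convAux a b n zero = a 0 *ℤ b n
convAux a b n (suc j) = a (suc j) *ℤ b (n ∸ suc j) +ℤ convAux a b n j

_⊛_ : Series → Series → Series
(a ⊛ b) n = convAux a b n n

denom : ℕ → Series
denom k zero = + 1
denom k (suc i) = if suc i <ᵇ k then -[1+ 0 ] else + 0

oneS : Series
oneS zero = + 1
oneS (suc _) = + 0

-- In a permutation avoiding 123 and 132 every entry has at most one larger entry to its
-- right. So the entries before the maximum n form a descending run n-1, n-2, …, n-j of the
-- largest remaining values, followed by n and an avoider of [1, n-1-j]; avoiding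
-- (k-1)…1k means exactly j ≤ k-2. Hence a_n = a_{n-1} + … + a_{n-k+1} with a_0 = 1, which
-- is the recurrence of F_{k-1, n+1} and says that (1 - x - … - x^{k-1}) f(x) = 1.
-- As S_n is enumerated as words, the decomposition is made one letter at a time: after the
-- run [j+b, …, b+1], the next letter is either the maximum (allowed iff j ≤ k-2, and then
-- only [1, b] remains), or b (extending the run); a smaller letter forms 123 or 132 with b
-- and the maximum, which must both come later.

module Submission where

open import Defs
open import Data.Bool using (Bool; true; false; _∧_; _∨_; not; if_then_else_)
open import Data.Bool.Properties using (∨-zeroʳ; ∧-zeroʳ)
open import Data.Bool.ListAction using (any; all)
open import Data.Empty using (⊥-elim)
open import Data.Integer using (ℤ; +_; -[1+_])
import Data.Integer as ℤ
import Data.Integer.Properties as ℤ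
open import Data.List using (List; []; _∷_; _++_; [_]; map; concatMap; length; take; filterᵇ; zip; downFrom; replicate; applyUpTo)
open import Data.List.Properties using (map-++; length-++; ++-assoc; map-cong; map-cong-local; map-applyUpTo)
open import Data.List.Membership.Propositional using (_∈_; _∉_)
open import Data.List.Membership.Propositional.Properties using (∈-++⁺ˡ; ∈-++⁺ʳ; ∈-++⁻)
open import Data.List.Relation.Binary.Sublist.Propositional using (_⊆_; []; _∷_; _∷ʳ_; ⊆-refl; minimum; from∈)
open import Data.List.Relation.Binary.Sublist.Propositional.Properties using (++⁺; ++⁺ˡ; map⁺)
open import Data.List.Relation.Unary.All as All using (All; []; _∷_)
import Data.List.Relation.Unary.All.Properties as All
open import Data.List.Relation.Unary.Any using (here; there)
open import Data.Nat using (ℕ; zero; suc; _+_; _∸_; _≤_; _<_; _<ᵇ_; _≡ᵇ_; z≤n; s≤s; z<s; s<s; _≟_; _≤?_)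
open import Data.List.Membership.DecPropositional _≟_ using (_∈?_)
open import Data.Nat.ListAction using (sum)
open import Data.Nat.ListAction.Properties using (sum-++)
open import Data.Nat.Properties
open import Data.Nat.Tactic.RingSolver using (solve-∀)
open import Data.Product using (_×_; _,_; proj₁; proj₂; ∃-syntax; uncurry′)
open import Data.Sum using (_⊎_; inj₁; inj₂)
open import Function using (_∘_; id)
open import Relation.Binary.Definitions using (tri<; tri≈; tri>)
open import Relation.Nullary using (¬_; yes; no)
open import Relation.Binary.PropositionalEquality hiding ([_])

private
  variable
    A B : Set
    m n : ℕ

<⇒<ᵇ-true : m < n → (m <ᵇ n) ≡ true
<⇒<ᵇ-true {zero} {suc n} _ = refl
<⇒<ᵇ-true {suc m} {suc n} (s≤s m<n) = <⇒<ᵇ-true m<n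

≥⇒<ᵇ-false : n ≤ m → (m <ᵇ n) ≡ false
≥⇒<ᵇ-false {zero} _ = refl
≥⇒<ᵇ-false {suc n} {suc m} (s≤s n≤m) = ≥⇒<ᵇ-false n≤m

<ᵇ-true⇒< : ∀ m n → (m <ᵇ n) ≡ true → m < n
<ᵇ-true⇒< zero (suc n) _ = z<s
<ᵇ-true⇒< (suc m) (suc n) eq = s<s (<ᵇ-true⇒< m n eq)

<ᵇ-false⇒≥ : ∀ m n → (m <ᵇ n) ≡ false → n ≤ m
<ᵇ-false⇒≥ m zero _ = z≤n
<ᵇ-false⇒≥ (suc m) (suc n) eq = s≤s (<ᵇ-false⇒≥ m n eq)

≡ᵇ-refl : ∀ m → (m ≡ᵇ m) ≡ true
≡ᵇ-refl zero = refl
≡ᵇ-refl (suc m) = ≡ᵇ-refl m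

≢⇒≡ᵇ-false : m ≢ n → (m ≡ᵇ n) ≡ false
≢⇒≡ᵇ-false {zero} {zero} m≢n = ⊥-elim (m≢n refl)
≢⇒≡ᵇ-false {zero} {suc n} _ = refl
≢⇒≡ᵇ-false {suc m} {zero} _ = refl
≢⇒≡ᵇ-false {suc m} {suc n} m≢n = ≢⇒≡ᵇ-false (m≢n ∘ cong suc)

∧-true⁻ : ∀ a {b} → a ∧ b ≡ true → a ≡ true × b ≡ true
∧-true⁻ true {true} _ = refl , refl

⇔ᵇ-true⇒≡ : ∀ {a b} → (a ⇔ᵇ b) ≡ true → a ≡ b
⇔ᵇ-true⇒≡ {true} {true} _ = refl
⇔ᵇ-true⇒≡ {false} {false} _ = refl

⇔ᵇ-refl : ∀ a → (a ⇔ᵇ a) ≡ true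
⇔ᵇ-refl true = refl
⇔ᵇ-refl false = refl

all-true⁻ : ∀ (p : A → Bool) xs → all p xs ≡ true → All (λ x → p x ≡ true) xs
all-true⁻ p [] _ = []
all-true⁻ p (x ∷ xs) eq = proj₁ (∧-true⁻ (p x) eq) ∷ all-true⁻ p xs (proj₂ (∧-true⁻ (p x) eq))

all-false⁻ : ∀ (p : A → Bool) xs → all p xs ≡ false → ∃[ x ] x ∈ xs × p x ≡ false
all-false⁻ p (x ∷ xs) eq with p x in px
... | false = x , here refl , px
... | true with all-false⁻ p xs eq
...   | y , y∈xs , py = y , there y∈xs , py

all-false : ∀ (p : A → Bool) {x xs} → x ∈ xs → p x ≡ false → all p xs ≡ false
all-false p (here refl) px rewrite px = refl
all-false p {xs = y ∷ _} (there x∈xs) px rewrite all-false p x∈xs px = ∧-zeroʳ (p y)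

all-map-true : ∀ (p : B → Bool) (f : A → B) xs → (∀ x → p (f x) ≡ true) → all p (map f xs) ≡ true
all-map-true p f [] _ = refl
all-map-true p f (x ∷ xs) h rewrite h x = all-map-true p f xs h

elemᵇ-true : ∀ {x ys} → x ∈ ys → elemᵇ x ys ≡ true
elemᵇ-true {x} (here refl) rewrite ≡ᵇ-refl x = refl
elemᵇ-true {x} {y ∷ ys} (there x∈ys) rewrite elemᵇ-true x∈ys = ∨-zeroʳ (x ≡ᵇ y)

elemᵇ-false : ∀ {x ys} → All (x ≢_) ys → elemᵇ x ys ≡ false
elemᵇ-false [] = refl
elemᵇ-false (x≢y ∷ x≢ys) rewrite ≢⇒≡ᵇ-false x≢y = elemᵇ-false x≢ys

elemᵇ-false⇒∉ : ∀ {x ys} → elemᵇ x ys ≡ false → x ∉ ys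
elemᵇ-false⇒∉ {x} eq x∈ys rewrite elemᵇ-true x∈ys with eq
... | ()

distinct-∷⁻ : ∀ x xs → distinct (x ∷ xs) ≡ true → x ∉ xs × distinct xs ≡ true
distinct-∷⁻ x xs eq with elemᵇ x xs in x∈?xs | eq
... | false | d = elemᵇ-false⇒∉ x∈?xs , d

distinct-++-false : ∀ {z} xs ys → z ∈ xs → z ∈ ys → distinct (xs ++ ys) ≡ false
distinct-++-false (x ∷ xs) ys (here refl) z∈ys rewrite elemᵇ-true (∈-++⁺ʳ xs z∈ys) = refl
distinct-++-false (x ∷ xs) ys (there z∈xs) z∈ys rewrite distinct-++-false xs ys z∈xs z∈ys = ∧-zeroʳ _

remove : ∀ {x : A} {xs} → x ∈ xs → List A
remove {xs = _ ∷ xs} (here _) = xs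
remove {xs = y ∷ _} (there x∈xs) = y ∷ remove x∈xs

length-remove : ∀ {x : A} {xs} (x∈xs : x ∈ xs) → length xs ≡ suc (length (remove x∈xs))
length-remove (here _) = refl
length-remove (there x∈xs) = cong suc (length-remove x∈xs)

∈-remove : ∀ {x z : A} {xs} (x∈xs : x ∈ xs) → z ∈ xs → z ≢ x → z ∈ remove x∈xs
∈-remove (here refl) (here refl) z≢x = ⊥-elim (z≢x refl)
∈-remove (here refl) (there z∈xs) _ = z∈xs
∈-remove (there _) (here refl) _ = here refl
∈-remove (there x∈xs) (there z∈xs) z≢x = there (∈-remove x∈xs z∈xs z≢x)

distinct-length-< : ∀ {a} xs ys → distinct xs ≡ true → All (_∈ ys) xs → a ∉ xs → a ∈ ys → length xs < length ys
distinct-length-< [] (_ ∷ _) _ _ _ _ = z<s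
distinct-length-< {a} (x ∷ xs) ys d (x∈ys ∷ xs⊆ys) a∉xxs a∈ys =
  subst (suc (length xs) <_) (sym (length-remove x∈ys))
    (s<s (distinct-length-< xs (remove x∈ys) (proj₂ (distinct-∷⁻ x xs d))
      (shrink xs⊆ys (proj₁ (distinct-∷⁻ x xs d)))
      (a∉xxs ∘ there) (∈-remove x∈ys a∈ys (a∉xxs ∘ here))))
  where
  shrink : ∀ {zs} → All (_∈ ys) zs → x ∉ zs → All (_∈ remove x∈ys) zs
  shrink [] _ = []
  shrink (z∈ys ∷ zs⊆ys) x∉zzs = ∈-remove x∈ys z∈ys (x∉zzs ∘ here ∘ sym) ∷ shrink zs⊆ys (x∉zzs ∘ there)

distinct-⊆-complete : ∀ {a} xs ys → distinct xs ≡ true → All (_∈ ys) xs → length ys ≤ length xs → a ∈ ys → a ∈ xs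
distinct-⊆-complete {a} xs ys d xs⊆ys ∣ys∣≤∣xs∣ a∈ys with a ∈? xs
... | yes a∈xs = a∈xs
... | no a∉xs = ⊥-elim (<⇒≱ (distinct-length-< xs ys d xs⊆ys a∉xs a∈ys) ∣ys∣≤∣xs∣)

countᵇ : (A → Bool) → List A → ℕ
countᵇ p [] = 0
countᵇ p (x ∷ xs) = if p x then suc (countᵇ p xs) else countᵇ p xs

length-filterᵇ : ∀ (p : A → Bool) xs → length (filterᵇ p xs) ≡ countᵇ p xs
length-filterᵇ p [] = refl
length-filterᵇ p (x ∷ xs) with p x
... | true = cong suc (length-filterᵇ p xs)
... | false = length-filterᵇ p xs

countᵇ-filterᵇ : ∀ (p q : A → Bool) xs → countᵇ q (filterᵇ p xs) ≡ countᵇ (λ x → p x ∧ q x) xs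
countᵇ-filterᵇ p q [] = refl
countᵇ-filterᵇ p q (x ∷ xs) with p x
... | false = countᵇ-filterᵇ p q xs
... | true with q x
...   | true = cong suc (countᵇ-filterᵇ p q xs)
...   | false = countᵇ-filterᵇ p q xs

countᵇ-++ : ∀ (p : A → Bool) xs ys → countᵇ p (xs ++ ys) ≡ countᵇ p xs + countᵇ p ys
countᵇ-++ p [] ys = refl
countᵇ-++ p (x ∷ xs) ys with p x
... | true = cong suc (countᵇ-++ p xs ys)
... | false = countᵇ-++ p xs ys

countᵇ-map : ∀ (p : B → Bool) (f : A → B) xs → countᵇ p (map f xs) ≡ countᵇ (p ∘ f) xs
countᵇ-map p f [] = refl
countᵇ-map p f (x ∷ xs) with p (f x)
... | true = cong suc (countᵇ-map p f xs)
... | false = countᵇ-map p f xs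

countᵇ-cong : ∀ {p q : A → Bool} xs → (∀ x → p x ≡ q x) → countᵇ p xs ≡ countᵇ q xs
countᵇ-cong [] _ = refl
countᵇ-cong {q = q} (x ∷ xs) p≗q rewrite p≗q x with q x
... | true = cong suc (countᵇ-cong xs p≗q)
... | false = countᵇ-cong xs p≗q

countᵇ-false : ∀ {p : A → Bool} xs → (∀ x → p x ≡ false) → countᵇ p xs ≡ 0
countᵇ-false [] _ = refl
countᵇ-false (x ∷ xs) p≡false rewrite p≡false x = countᵇ-false xs p≡false

countᵇ-concatMap : ∀ (p : B → Bool) (f : A → List B) xs →
  countᵇ p (concatMap f xs) ≡ sum (map (countᵇ p ∘ f) xs)
countᵇ-concatMap p f [] = refl
countᵇ-concatMap p f (x ∷ xs) =
  trans (countᵇ-++ p (f x) (concatMap f xs)) (cong (_+_ (countᵇ p (f x))) (countᵇ-concatMap p f xs))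

countᵇ-words-suc : ∀ (p : List A → Bool) xs m →
  countᵇ p (words xs (suc m)) ≡ sum (map (λ x → countᵇ (p ∘ (x ∷_)) (words xs m)) xs)
countᵇ-words-suc p xs m =
  trans (countᵇ-concatMap p (λ x → map (x ∷_) (words xs m)) xs)
        (cong sum (map-cong (λ x → countᵇ-map p (x ∷_) (words xs m)) xs))

countᵇ-words-cong : ∀ {p q : List A → Bool} xs m →
  (∀ w → length w ≡ m → All (_∈ xs) w → p w ≡ q w) → countᵇ p (words xs m) ≡ countᵇ q (words xs m)
countᵇ-words-cong {p = p} xs zero p≗q rewrite p≗q [] refl [] = refl
countᵇ-words-cong {p = p} {q} xs (suc m) p≗q = begin
  countᵇ p (words xs (suc m))                                 ≡⟨ countᵇ-words-suc p xs m ⟩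
  sum (map (λ x → countᵇ (p ∘ (x ∷_)) (words xs m)) xs)     ≡⟨ cong sum (map-cong-local (All.tabulate {xs = xs} first-letter)) ⟩
  sum (map (λ x → countᵇ (q ∘ (x ∷_)) (words xs m)) xs)     ≡⟨ countᵇ-words-suc q xs m ⟨
  countᵇ q (words xs (suc m))                                 ∎
  where
  open ≡-Reasoning
  first-letter : ∀ {x} → x ∈ xs → countᵇ (p ∘ (x ∷_)) (words xs m) ≡ countᵇ (q ∘ (x ∷_)) (words xs m)
  first-letter x∈xs = countᵇ-words-cong xs m (λ w ∣w∣≡m w⊆xs → p≗q _ (cong suc ∣w∣≡m) (x∈xs ∷ w⊆xs))

countᵇ-words-false : ∀ {p : List A → Bool} xs m →
  (∀ w → length w ≡ m → All (_∈ xs) w → p w ≡ false) → countᵇ p (words xs m) ≡ 0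
countᵇ-words-false xs m p≡false =
  trans (countᵇ-words-cong xs m p≡false) (countᵇ-false (words xs m) (λ _ → refl))

range : ℕ → ℕ → List ℕ
range a zero = []
range a (suc n) = a ∷ range (suc a) n

applyUpTo≡range : ∀ a (f : ℕ → ℕ) n → (∀ i → f i ≡ a + i) → applyUpTo f n ≡ range a n
applyUpTo≡range a f zero _ = refl
applyUpTo≡range a f (suc n) f≗a+ =
  cong₂ _∷_ (trans (f≗a+ 0) (+-identityʳ a))
            (applyUpTo≡range (suc a) (f ∘ suc) n (λ i → trans (f≗a+ (suc i)) (+-suc a i)))

oneTo≡range : ∀ n → oneTo n ≡ range 1 n
oneTo≡range n = trans (map-applyUpTo id suc n) (applyUpTo≡range 1 suc n (λ _ → refl))

length-range : ∀ a n → length (range a n) ≡ n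
length-range a zero = refl
length-range a (suc n) = cong suc (length-range (suc a) n)

range-++ : ∀ a m n → range a (m + n) ≡ range a m ++ range (m + a) n
range-++ a zero n = refl
range-++ a (suc m) n = cong (a ∷_) (trans (range-++ (suc a) m n) (cong (λ b → range (suc a) m ++ range b n) (+-suc m a)))

range-∷ʳ : ∀ a n → range a (suc n) ≡ range a n ++ [ n + a ]
range-∷ʳ a zero = refl
range-∷ʳ a (suc n) = cong (a ∷_) (trans (range-∷ʳ (suc a) n) (cong (λ b → range (suc a) n ++ [ b ]) (+-suc n a)))

∈-range⁺ : ∀ {a n z} → a ≤ z → z < n + a → z ∈ range a n
∈-range⁺ {a} {zero} a≤z z<a = ⊥-elim (<⇒≱ z<a a≤z)
∈-range⁺ {a} {suc n} {z} a≤z z<n+a with a ≟ z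
... | yes refl = here refl
... | no a≢z = there (∈-range⁺ (≤∧≢⇒< a≤z a≢z) (subst (z <_) (sym (+-suc n a)) z<n+a))

∈-range⁻ : ∀ {a n z} → z ∈ range a n → a ≤ z × z < n + a
∈-range⁻ {a} {suc n} (here refl) = ≤-refl , s≤s (m≤n+m a n)
∈-range⁻ {a} {suc n} {z} (there z∈range) with ∈-range⁻ {suc a} {n} z∈range
... | a<z , z<n+1+a = <⇒≤ a<z , subst (z <_) (+-suc n a) z<n+1+a

sum-range-cong : ∀ (f g : ℕ → ℕ) a n → (∀ y → a ≤ y → y < n + a → f y ≡ g y) →
  sum (map f (range a n)) ≡ sum (map g (range a n))
sum-range-cong f g a n f≗g = cong sum (map-cong-local (All.tabulate (λ y∈range → uncurry′ (f≗g _) (∈-range⁻ y∈range))))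

sum-range-zero : ∀ (f : ℕ → ℕ) a n → (∀ y → a ≤ y → y < n + a → f y ≡ 0) → sum (map f (range a n)) ≡ 0
sum-range-zero f a zero _ = refl
sum-range-zero f a (suc n) f≡0 rewrite f≡0 a ≤-refl (s≤s (m≤n+m a n)) =
  sum-range-zero f (suc a) n (λ y a<y y<n+1+a → f≡0 y (<⇒≤ a<y) (subst (y <_) (+-suc n a) y<n+1+a))

sum-range-single : ∀ (f : ℕ → ℕ) a n c → a ≤ c → c < n + a →
  (∀ y → a ≤ y → y < n + a → y ≢ c → f y ≡ 0) → sum (map f (range a n)) ≡ f c
sum-range-single f a zero c a≤c c<a _ = ⊥-elim (<⇒≱ c<a a≤c)
sum-range-single f a (suc n) c a≤c c<n+a f≡0 with a ≟ c
... | yes refl = trans (cong (_+_ (f a)) (sum-range-zero f (suc a) n above)) (+-identityʳ (f a))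
  where
  above : ∀ y → suc a ≤ y → y < n + suc a → f y ≡ 0
  above y a<y y<n+1+a = f≡0 y (<⇒≤ a<y) (subst (y <_) (+-suc n a) y<n+1+a) (>⇒≢ a<y)
... | no a≢c rewrite f≡0 a ≤-refl (s≤s (m≤n+m a n)) a≢c =
  sum-range-single f (suc a) n c (≤∧≢⇒< a≤c a≢c) (subst (c <_) (sym (+-suc n a)) c<n+a)
    (λ y a<y y<n+1+a → f≡0 y (<⇒≤ a<y) (subst (y <_) (+-suc n a) y<n+1+a))

all≤ᵇ : ℕ → List ℕ → Bool
all≤ᵇ c = all (λ z → z <ᵇ suc c)

countᵇ-words-all≤ : ∀ (p : List ℕ → Bool) c n m → c ≤ n →
  countᵇ (λ w → all≤ᵇ c w ∧ p w) (words (range 1 n) m) ≡ countᵇ p (words (range 1 c) m)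
countᵇ-words-all≤ p c n zero c≤n = refl
countᵇ-words-all≤ p c n (suc m) c≤n = begin
  countᵇ (λ w → all≤ᵇ c w ∧ p w) (words (range 1 n) (suc m))    ≡⟨ countᵇ-words-suc _ (range 1 n) m ⟩
  sum (map first (range 1 n))                                     ≡⟨ cong (sum ∘ map first) range-split ⟩
  sum (map first (range 1 c ++ range (c + 1) (n ∸ c)))            ≡⟨ cong sum (map-++ first (range 1 c) _) ⟩
  sum (map first (range 1 c) ++ map first (range (c + 1) (n ∸ c))) ≡⟨ sum-++ (map first (range 1 c)) _ ⟩
  sum (map first (range 1 c)) + sum (map first (range (c + 1) (n ∸ c)))
    ≡⟨ cong₂ _+_ (sum-range-cong first first′ 1 c low) (sum-range-zero first (c + 1) (n ∸ c) high) ⟩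
  sum (map first′ (range 1 c)) + 0                                ≡⟨ +-identityʳ _ ⟩
  sum (map first′ (range 1 c))                                    ≡⟨ countᵇ-words-suc p (range 1 c) m ⟨
  countᵇ p (words (range 1 c) (suc m))                            ∎
  where
  open ≡-Reasoning
  first first′ : ℕ → ℕ
  first x = countᵇ (λ w → all≤ᵇ c (x ∷ w) ∧ p (x ∷ w)) (words (range 1 n) m)
  first′ x = countᵇ (p ∘ (x ∷_)) (words (range 1 c) m)
  range-split : range 1 n ≡ range 1 c ++ range (c + 1) (n ∸ c)
  range-split = trans (cong (range 1) (sym (m+[n∸m]≡n c≤n))) (range-++ 1 c (n ∸ c))
  low : ∀ y → 1 ≤ y → y < c + 1 → first y ≡ first′ y
  low y _ y<c+1 rewrite <⇒<ᵇ-true (subst (y <_) (+-comm c 1) y<c+1) =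
    countᵇ-words-all≤ (p ∘ (y ∷_)) c n m c≤n
  high : ∀ y → c + 1 ≤ y → y < n ∸ c + (c + 1) → first y ≡ 0
  high y c<y _ rewrite ≥⇒<ᵇ-false (subst (_≤ y) (+-comm c 1) c<y) = countᵇ-false (words (range 1 n) m) (λ _ → refl)

any-++ : ∀ (p : A → Bool) xs ys → any p (xs ++ ys) ≡ any p xs ∨ any p ys
any-++ p [] ys = refl
any-++ p (x ∷ xs) ys with p x
... | true = refl
... | false = any-++ p xs ys

any-map : ∀ (p : B → Bool) (f : A → B) xs → any p (map f xs) ≡ any (p ∘ f) xs
any-map p f [] = refl
any-map p f (x ∷ xs) = cong (p (f x) ∨_) (any-map p f xs)

any-subseqs-∷ : ∀ (p : List A → Bool) x xs →
  any p (subseqs (x ∷ xs)) ≡ any (p ∘ (x ∷_)) (subseqs xs) ∨ any p (subseqs xs)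
any-subseqs-∷ p x xs =
  trans (any-++ p (map (x ∷_) (subseqs xs)) (subseqs xs)) (cong (_∨ any p (subseqs xs)) (any-map p (x ∷_) (subseqs xs)))

any-subseqs⁺ : ∀ (p : List A → Bool) {s xs} → s ⊆ xs → p s ≡ true → any p (subseqs xs) ≡ true
any-subseqs⁺ p [] ps rewrite ps = refl
any-subseqs⁺ p {xs = x ∷ xs} (x ∷ʳ s⊆xs) ps rewrite any-subseqs-∷ p x xs | any-subseqs⁺ p s⊆xs ps = ∨-zeroʳ _
any-subseqs⁺ p {xs = x ∷ xs} (refl ∷ s⊆xs) ps rewrite any-subseqs-∷ p x xs | any-subseqs⁺ (p ∘ (x ∷_)) s⊆xs ps = refl

any-subseqs⁻ : ∀ (p : List A → Bool) xs → any p (subseqs xs) ≡ true → ∃[ s ] s ⊆ xs × p s ≡ true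
any-subseqs⁻ p [] eq with p [] in p[]
... | true = [] , [] , p[]
any-subseqs⁻ p (x ∷ xs) eq rewrite any-subseqs-∷ p x xs with any (p ∘ (x ∷_)) (subseqs xs) in eqˣ
... | true with any-subseqs⁻ (p ∘ (x ∷_)) xs eqˣ
...   | s , s⊆xs , ps = x ∷ s , refl ∷ s⊆xs , ps
any-subseqs⁻ p (x ∷ xs) eq | false with any-subseqs⁻ p xs eq
...   | s , s⊆xs , ps = s , x ∷ʳ s⊆xs , ps

headOccurrenceᵇ : ℕ → List ℕ → List ℕ → Bool
headOccurrenceᵇ x π σ = any (λ s → orderIsoᵇ (x ∷ s) σ) (subseqs π)

containsᵇ-∷ : ∀ x π σ → containsᵇ (x ∷ π) σ ≡ headOccurrenceᵇ x π σ ∨ containsᵇ π σ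
containsᵇ-∷ x π σ = any-subseqs-∷ (λ s → orderIsoᵇ s σ) x π

containsᵇ-⊆ : ∀ {s π} σ → s ⊆ π → orderIsoᵇ s σ ≡ true → containsᵇ π σ ≡ true
containsᵇ-⊆ σ = any-subseqs⁺ (λ s → orderIsoᵇ s σ)

orderIsoᵇ-head : ∀ x s a σ → orderIsoᵇ (x ∷ s) (a ∷ σ) ≡ true → map (x <ᵇ_) s ≡ map (a <ᵇ_) σ
orderIsoᵇ-head x s a σ iso with ∧-true⁻ (sameLength s σ) iso
... | same , table with ∧-true⁻ (all (λ q → (x <ᵇ proj₁ q) ⇔ᵇ (a <ᵇ proj₂ q)) ((x , a) ∷ zip s σ)) table
...   | top-row , _ = row s σ same (proj₂ (∧-true⁻ ((x <ᵇ x) ⇔ᵇ (a <ᵇ a)) top-row))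
  where
  row : ∀ s σ → sameLength s σ ≡ true →
    all (λ q → (x <ᵇ proj₁ q) ⇔ᵇ (a <ᵇ proj₂ q)) (zip s σ) ≡ true → map (x <ᵇ_) s ≡ map (a <ᵇ_) σ
  row [] [] _ _ = refl
  row (y ∷ s) (b ∷ σ) same r with ∧-true⁻ ((x <ᵇ y) ⇔ᵇ (a <ᵇ b)) r
  ... | y~b , rest = cong₂ _∷_ (⇔ᵇ-true⇒≡ y~b) (row s σ same rest)

-- An occurrence x ∷ s of a ∷ σ embeds map (a <ᵇ_) σ = map (x <ᵇ_) s into map (x <ᵇ_) π.
headOccurrenceᵇ-false : ∀ x π a σ → ¬ map (a <ᵇ_) σ ⊆ map (x <ᵇ_) π → headOccurrenceᵇ x π (a ∷ σ) ≡ false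
headOccurrenceᵇ-false x π a σ ¬σ⊆π with headOccurrenceᵇ x π (a ∷ σ) in occ
... | false = refl
... | true with any-subseqs⁻ (λ s → orderIsoᵇ (x ∷ s) (a ∷ σ)) π occ
...   | s , s⊆π , iso = ⊥-elim (¬σ⊆π (subst (_⊆ map (x <ᵇ_) π) (orderIsoᵇ-head x s a σ iso) (map⁺ (x <ᵇ_) s⊆π)))

sameLength-map : ∀ (f : ℕ → ℕ) ys → sameLength (map f ys) ys ≡ true
sameLength-map f [] = refl
sameLength-map f (y ∷ ys) = sameLength-map f ys

zip-map-self : ∀ (f : A → B) ys → zip (map f ys) ys ≡ map (λ y → f y , y) ys
zip-map-self f [] = refl
zip-map-self f (y ∷ ys) = cong ((f y , y) ∷_) (zip-map-self f ys)

orderIsoᵇ-map : ∀ (f : ℕ → ℕ) → (∀ a b → (f a <ᵇ f b) ≡ (a <ᵇ b)) → ∀ ys → orderIsoᵇ (map f ys) ys ≡ true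
orderIsoᵇ-map f f-<ᵇ ys rewrite sameLength-map f ys | zip-map-self f ys =
  all-map-true _ (λ y → f y , y) ys (λ y → all-map-true _ (λ y → f y , y) ys
    (λ y′ → subst (λ b → (b ⇔ᵇ (y <ᵇ y′)) ≡ true) (sym (f-<ᵇ y y′)) (⇔ᵇ-refl (y <ᵇ y′))))

+-<ᵇ : ∀ d a b → ((d + a) <ᵇ (d + b)) ≡ (a <ᵇ b)
+-<ᵇ zero a b = refl
+-<ᵇ (suc d) a b = +-<ᵇ d a b

orderIsoᵇ-123 : ∀ {x y z} → x < y → y < z → orderIsoᵇ (x ∷ y ∷ z ∷ []) (1 ∷ 2 ∷ 3 ∷ []) ≡ true
orderIsoᵇ-123 {x} {y} {z} x<y y<z
  rewrite ≥⇒<ᵇ-false (≤-refl {x}) | ≥⇒<ᵇ-false (≤-refl {y}) | ≥⇒<ᵇ-false (≤-refl {z})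
        | <⇒<ᵇ-true x<y | <⇒<ᵇ-true y<z | <⇒<ᵇ-true (<-trans x<y y<z)
        | ≥⇒<ᵇ-false (<⇒≤ x<y) | ≥⇒<ᵇ-false (<⇒≤ y<z) | ≥⇒<ᵇ-false (<⇒≤ (<-trans x<y y<z)) = refl

orderIsoᵇ-132 : ∀ {x y z} → x < z → z < y → orderIsoᵇ (x ∷ y ∷ z ∷ []) (1 ∷ 3 ∷ 2 ∷ []) ≡ true
orderIsoᵇ-132 {x} {y} {z} x<z z<y
  rewrite ≥⇒<ᵇ-false (≤-refl {x}) | ≥⇒<ᵇ-false (≤-refl {y}) | ≥⇒<ᵇ-false (≤-refl {z})
        | <⇒<ᵇ-true x<z | <⇒<ᵇ-true z<y | <⇒<ᵇ-true (<-trans x<z z<y)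
        | ≥⇒<ᵇ-false (<⇒≤ x<z) | ≥⇒<ᵇ-false (<⇒≤ z<y) | ≥⇒<ᵇ-false (<⇒≤ (<-trans x<z z<y)) = refl

pair-⊆ : ∀ {a b : A} {xs} → a ∈ xs → b ∈ xs → a ≢ b → (a ∷ b ∷ []) ⊆ xs ⊎ (b ∷ a ∷ []) ⊆ xs
pair-⊆ (here refl) (here refl) a≢b = ⊥-elim (a≢b refl)
pair-⊆ (here refl) (there b∈xs) _ = inj₁ (refl ∷ from∈ b∈xs)
pair-⊆ (there a∈xs) (here refl) _ = inj₂ (refl ∷ from∈ a∈xs)
pair-⊆ {xs = x ∷ _} (there a∈xs) (there b∈xs) a≢b with pair-⊆ a∈xs b∈xs a≢b
... | inj₁ ab⊆xs = inj₁ (x ∷ʳ ab⊆xs)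
... | inj₂ ba⊆xs = inj₂ (x ∷ʳ ba⊆xs)

countᵇ-mono-⊆ : ∀ (p : A → Bool) {xs ys} → xs ⊆ ys → countᵇ p xs ≤ countᵇ p ys
countᵇ-mono-⊆ p [] = z≤n
countᵇ-mono-⊆ p (y ∷ʳ xs⊆ys) with p y
... | true = m≤n⇒m≤1+n (countᵇ-mono-⊆ p xs⊆ys)
... | false = countᵇ-mono-⊆ p xs⊆ys
countᵇ-mono-⊆ p {x ∷ _} (refl ∷ xs⊆ys) with p x
... | true = s≤s (countᵇ-mono-⊆ p xs⊆ys)
... | false = countᵇ-mono-⊆ p xs⊆ys

countᵇ-replicate-false : ∀ n zs → countᵇ id (replicate n false ++ zs) ≡ countᵇ id zs
countᵇ-replicate-false zero zs = refl
countᵇ-replicate-false (suc n) zs = countᵇ-replicate-false n zs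

countᵇ-id-replicate-false : ∀ n → countᵇ id (replicate n false) ≡ 0
countᵇ-id-replicate-false zero = refl
countᵇ-id-replicate-false (suc n) = countᵇ-id-replicate-false n

falses-true-⊈-falses : ∀ a n → ¬ replicate a false ++ [ true ] ⊆ replicate n false
falses-true-⊈-falses a n sub with countᵇ-mono-⊆ id sub
... | count≤ rewrite countᵇ-replicate-false a [ true ] | countᵇ-id-replicate-false n with count≤
...   | ()

-- If the remaining entries are all false, a ⊆-embedding must send the true to the true.
falses-true-⊆⇒≤ : ∀ a b zs → replicate a false ++ [ true ] ⊆ replicate b false ++ true ∷ zs →
  countᵇ id zs ≡ 0 → a ≤ b
falses-true-⊆⇒≤ zero b zs _ _ = z≤n
falses-true-⊆⇒≤ (suc a) zero zs (true ∷ʳ sub) zs≡0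
  with countᵇ-mono-⊆ id sub | countᵇ-replicate-false a [ true ]
... | sub≤ | eq rewrite eq | zs≡0 with sub≤
...   | ()
falses-true-⊆⇒≤ (suc a) (suc b) zs (refl ∷ sub) zs≡0 = s≤s (falses-true-⊆⇒≤ a b zs sub zs≡0)
falses-true-⊆⇒≤ (suc a) (suc b) zs (false ∷ʳ sub) zs≡0 = m≤n⇒m≤1+n (falses-true-⊆⇒≤ (suc a) b zs sub zs≡0)

map-<ᵇ-false : ∀ x ys → All (_≤ x) ys → map (x <ᵇ_) ys ≡ replicate (length ys) false
map-<ᵇ-false x [] _ = refl
map-<ᵇ-false x (y ∷ ys) (y≤x ∷ ys≤x) = cong₂ _∷_ (≥⇒<ᵇ-false y≤x) (map-<ᵇ-false x ys ys≤x)

-- Descending runs: descent c l = [l - 1 + c, …, c + 1, c]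

descent : ℕ → ℕ → List ℕ
descent c zero = []
descent c (suc l) = l + c ∷ descent c l

∈-descent⁻ : ∀ {c l z} → z ∈ descent c l → c ≤ z × z < l + c
∈-descent⁻ {c} {suc l} (here refl) = m≤n+m c l , ≤-refl
∈-descent⁻ {c} {suc l} (there z∈run) with ∈-descent⁻ z∈run
... | c≤z , z<l+c = c≤z , m<n⇒m<1+n z<l+c

∈-descent⁺ : ∀ {c l z} → c ≤ z → z < l + c → z ∈ descent c l
∈-descent⁺ {c} {zero} c≤z z<c = ⊥-elim (<⇒≱ z<c c≤z)
∈-descent⁺ {c} {suc l} {z} c≤z z<1+l+c with z ≟ l + c
... | yes refl = here refl
... | no z≢l+c = there (∈-descent⁺ c≤z (≤∧≢⇒< (≤-pred z<1+l+c) z≢l+c))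

length-descent : ∀ c l → length (descent c l) ≡ l
length-descent c zero = refl
length-descent c (suc l) = cong suc (length-descent c l)

descent-++ : ∀ c l e → descent c (l + e) ≡ descent (e + c) l ++ descent c e
descent-++ c zero e = refl
descent-++ c (suc l) e = cong₂ _∷_ (+-assoc l e c) (descent-++ c l e)

descent-∷ʳ : ∀ b j → descent (suc b) j ++ [ b ] ≡ descent b (suc j)
descent-∷ʳ b zero = refl
descent-∷ʳ b (suc j) = cong₂ _∷_ (+-suc j b) (descent-∷ʳ b j)

map-+-downFrom : ∀ d m → map (_+_ d) (map suc (downFrom m)) ≡ descent (suc d) m
map-+-downFrom d zero = refl
map-+-downFrom d (suc m) = cong₂ _∷_ (trans (+-suc d m) (+-comm (suc d) m)) (map-+-downFrom d m)

-- The m-step Fibonacci recurrence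

-- history a n = [a n, …, a 0, 0]; the trailing 0 plays the role of F_{k,0} in fibTable.
history : (ℕ → ℕ) → ℕ → List ℕ
history a zero = a 0 ∷ 0 ∷ []
history a (suc n) = a (suc n) ∷ history a n

sum-take-[0] : ∀ t → sum (take t [ 0 ]) ≡ 0
sum-take-[0] zero = refl
sum-take-[0] (suc zero) = refl
sum-take-[0] (suc (suc t)) = refl

-- windowSum a m N i = Σ { a t | t ≤ i, N - t < m }
windowSum : (ℕ → ℕ) → ℕ → ℕ → ℕ → ℕ
windowSum a m N zero = if N <ᵇ m then a 0 else 0
windowSum a m N (suc i) = (if N ∸ suc i <ᵇ m then a (suc i) else 0) + windowSum a m N i

windowSum-zero : ∀ a N i → windowSum a 0 N i ≡ 0
windowSum-zero a N zero = refl
windowSum-zero a N (suc i) = windowSum-zero a N i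

windowSum-suc : ∀ a m N i → i ≤ N → windowSum a (suc m) (suc N) i ≡ windowSum a m N i
windowSum-suc a m N zero _ = refl
windowSum-suc a m N (suc i) i<N rewrite +-∸-assoc 1 i<N = cong (_+_ _) (windowSum-suc a m N i (<⇒≤ i<N))

windowSum-history : ∀ a m N → windowSum a m N N ≡ sum (take m (history a N))
windowSum-history a zero N = windowSum-zero a N N
windowSum-history a (suc m) zero = sym (trans (cong (_+_ (a 0)) (sum-take-[0] m)) (+-identityʳ (a 0)))
windowSum-history a (suc m) (suc N)
  rewrite n∸n≡0 N | windowSum-suc a m N N ≤-refl = cong (_+_ (a (suc N))) (windowSum-history a m N)

module Recurrence (m : ℕ) (a : ℕ → ℕ) (a₀≡1 : a 0 ≡ 1)
  (a-rec : ∀ n → a (suc n) ≡ sum (take m (history a n))) where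

  fibTable≡history : ∀ n → fibTable m (suc n) ≡ history a n
  fibTable≡history zero = cong (λ x → x ∷ 0 ∷ []) (sym a₀≡1)
  fibTable≡history (suc n) =
    cong₂ _∷_ (trans (cong (sum ∘ take m) (fibTable≡history n)) (sym (a-rec n))) (fibTable≡history n)

  F≡a : ∀ n → F m (+ suc n) ≡ a n
  F≡a zero = sym a₀≡1
  F≡a (suc n) = cong headOr0 (fibTable≡history (suc n))

  *-denom-suc : ∀ x r → + x ℤ.* denom (suc m) (suc r) ≡ ℤ.- (+ (if r <ᵇ m then x else 0))
  *-denom-suc x r with r <ᵇ m
  ... | true = trans (ℤ.*-comm (+ x) (ℤ.- (+ 1))) (ℤ.-1*i≡-i (+ x))
  ... | false = ℤ.*-zeroʳ (+ x)

  convAux-denom : ∀ N i → i ≤ N → convAux (λ t → + a t) (denom (suc m)) (suc N) i ≡ ℤ.- (+ windowSum a m N i)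
  convAux-denom N zero _ = *-denom-suc (a 0) N
  convAux-denom N (suc i) i<N rewrite +-∸-assoc 1 i<N =
    trans (cong₂ ℤ._+_ (*-denom-suc (a (suc i)) (N ∸ suc i)) (convAux-denom N i (<⇒≤ i<N)))
          (trans (sym (ℤ.neg-distrib-+ (+ _) (+ windowSum a m N i))) (cong ℤ.-_ (sym (ℤ.pos-+ _ (windowSum a m N i)))))

  generatingFunction : ∀ n → ((λ t → + a t) ⊛ denom (suc m)) n ≡ oneS n
  generatingFunction zero = cong (λ x → + x ℤ.* + 1) a₀≡1
  generatingFunction (suc N) rewrite n∸n≡0 N | convAux-denom N N ≤-refl | ℤ.*-identityʳ (+ a (suc N))
                                   | a-rec N | sym (windowSum-history a m N) = ℤ.+-inverseʳ (+ windowSum a m N N)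

-- Avoiders of 123, 132 and (k-1)(k-2)…1k, where k = k′ + 2

module Avoidance (k′ : ℕ) where

  R : List (List ℕ)
  R = (1 ∷ 2 ∷ 3 ∷ []) ∷ (1 ∷ 3 ∷ 2 ∷ []) ∷ decThenMax (suc (suc k′)) ∷ []

  avoiderᵇ : List ℕ → Bool
  avoiderᵇ w = distinct w ∧ avoidsAllᵇ R w

  avoiderᵇ-contains : ∀ {σ} π → σ ∈ R → containsᵇ π σ ≡ true → avoiderᵇ π ≡ false
  avoiderᵇ-contains π σ∈R π⊇σ
    rewrite all-false (λ σ → not (containsᵇ π σ)) σ∈R (cong not π⊇σ) = ∧-zeroʳ (distinct π)

  avoiderᵇ-duplicate : ∀ {z} xs ys → z ∈ xs → z ∈ ys → avoiderᵇ (xs ++ ys) ≡ false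
  avoiderᵇ-duplicate xs ys z∈xs z∈ys rewrite distinct-++-false xs ys z∈xs z∈ys = refl

  decThenMax-comparisons : map (suc k′ <ᵇ_) (map suc (downFrom k′) ++ [ suc (suc k′) ]) ≡ replicate k′ false ++ [ true ]
  decThenMax-comparisons = trans (map-++ (suc k′ <ᵇ_) (map suc (downFrom k′)) [ suc (suc k′) ])
    (cong₂ _++_ (smaller k′ ≤-refl) (cong [_] (<⇒<ᵇ-true (n<1+n k′))))
    where
    smaller : ∀ j → j ≤ k′ → map (suc k′ <ᵇ_) (map suc (downFrom j)) ≡ replicate j false
    smaller zero _ = refl
    smaller (suc j) j<k′ = cong₂ _∷_ (≥⇒<ᵇ-false (<⇒≤ j<k′)) (smaller j (<⇒≤ j<k′))

  -- The head x of x ∷ π starts an occurrence of 123 or 132 only if two later entries exceed it,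
  -- and of (k-1)…1k only if k′ smaller entries are followed by a larger one.
  avoidsAllᵇ-∷ : ∀ x π → countᵇ id (map (x <ᵇ_) π) ≤ 1 →
    ¬ replicate k′ false ++ [ true ] ⊆ map (x <ᵇ_) π → avoidsAllᵇ R (x ∷ π) ≡ avoidsAllᵇ R π
  avoidsAllᵇ-∷ x π ≤1 ¬late-larger
    rewrite containsᵇ-∷ x π (1 ∷ 2 ∷ 3 ∷ []) | containsᵇ-∷ x π (1 ∷ 3 ∷ 2 ∷ [])
          | containsᵇ-∷ x π (decThenMax (suc (suc k′)))
          | headOccurrenceᵇ-false x π 1 (2 ∷ 3 ∷ []) (λ sub → <-irrefl refl (≤-trans (countᵇ-mono-⊆ id sub) ≤1))
          | headOccurrenceᵇ-false x π 1 (3 ∷ 2 ∷ []) (λ sub → <-irrefl refl (≤-trans (countᵇ-mono-⊆ id sub) ≤1))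
          | headOccurrenceᵇ-false x π (suc k′) (map suc (downFrom k′) ++ [ suc (suc k′) ])
              (¬late-larger ∘ subst (_⊆ map (x <ᵇ_) π) decThenMax-comparisons) = refl

  avoiderᵇ-∷ : ∀ x π → elemᵇ x π ≡ false → countᵇ id (map (x <ᵇ_) π) ≤ 1 →
    ¬ replicate k′ false ++ [ true ] ⊆ map (x <ᵇ_) π → avoiderᵇ (x ∷ π) ≡ avoiderᵇ π
  avoiderᵇ-∷ x π x∉π ≤1 ¬late-larger rewrite x∉π | avoidsAllᵇ-∷ x π ≤1 ¬late-larger = refl

  avoiderᵇ-descent-top : ∀ l c N w → l ≤ k′ → l + c ≤ N → All (_< c) w →
    avoiderᵇ (descent c l ++ N ∷ w) ≡ avoiderᵇ w
  avoiderᵇ-descent-top zero c N w _ c≤N w<c =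
    avoiderᵇ-∷ N w (elemᵇ-false (All.map (λ z<c → >⇒≢ (<-≤-trans z<c c≤N)) w<c))
      (subst (λ bs → countᵇ id bs ≤ 1) (sym profile) (subst (_≤ 1) (sym (countᵇ-id-replicate-false (length w))) z≤n))
      (subst (λ bs → ¬ replicate k′ false ++ [ true ] ⊆ bs) (sym profile) (falses-true-⊈-falses k′ (length w)))
    where
    profile : map (N <ᵇ_) w ≡ replicate (length w) false
    profile = map-<ᵇ-false N w (All.map (λ z<c → ≤-trans (<⇒≤ z<c) c≤N) w<c)
  avoiderᵇ-descent-top (suc l) c N w l<k′ l+c<N w<c =
    trans (avoiderᵇ-∷ x π x∉π count≤1 ¬late-larger) (avoiderᵇ-descent-top l c N w (<⇒≤ l<k′) (<⇒≤ l+c<N) w<c)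
    where
    x = l + c
    π = descent c l ++ N ∷ w
    w<x : All (_< x) w
    w<x = All.map (λ z<c → <-≤-trans z<c (m≤n+m c l)) w<c
    x∉π : elemᵇ x π ≡ false
    x∉π = elemᵇ-false (All.++⁺ (All.tabulate {xs = descent c l} (λ z∈run → <⇒≢ (proj₂ (∈-descent⁻ z∈run)) ∘ sym))
                               (<⇒≢ l+c<N ∷ All.map (λ z<x → >⇒≢ z<x) w<x))
    profile : map (x <ᵇ_) π ≡ replicate l false ++ true ∷ replicate (length w) false
    profile = trans (map-++ (x <ᵇ_) (descent c l) (N ∷ w))
      (cong₂ _++_ (trans (map-<ᵇ-false x (descent c l) (All.tabulate {xs = descent c l} (<⇒≤ ∘ proj₂ ∘ ∈-descent⁻)))
                         (cong (λ n → replicate n false) (length-descent c l)))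
                  (cong₂ _∷_ (<⇒<ᵇ-true l+c<N) (map-<ᵇ-false x w (All.map <⇒≤ w<x))))
    count≤1 : countᵇ id (map (x <ᵇ_) π) ≤ 1
    count≤1 rewrite profile | countᵇ-replicate-false l (true ∷ replicate (length w) false)
                  | countᵇ-id-replicate-false (length w) = ≤-refl
    ¬late-larger : ¬ replicate k′ false ++ [ true ] ⊆ map (x <ᵇ_) π
    ¬late-larger sub rewrite profile =
      <⇒≱ l<k′ (falses-true-⊆⇒≤ k′ l (replicate (length w) false) sub (countᵇ-id-replicate-false (length w)))

  avoiderᵇ-long-descent-top : ∀ c j w → k′ < j → avoiderᵇ (descent (suc c) j ++ (j + suc c) ∷ w) ≡ false
  avoiderᵇ-long-descent-top c j w k′<j
    rewrite sym (m+[n∸m]≡n k′<j) = avoiderᵇ-contains π (there (there (here refl))) (containsᵇ-⊆ τ occ⊆π occ≅τ)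
    where
    e = j ∸ suc k′
    d = e + c
    N = suc k′ + e + suc c
    τ = decThenMax (suc (suc k′))
    π = descent (suc c) (suc k′ + e) ++ N ∷ w
    occ = descent (e + suc c) (suc k′) ++ [ N ]
    top-entry : ∀ k e c → e + c + suc (suc k) ≡ suc k + e + suc c
    top-entry = solve-∀
    translate : map (_+_ d) τ ≡ occ
    translate = trans (map-++ (_+_ d) (map suc (downFrom (suc k′))) [ suc (suc k′) ])
      (cong₂ _++_ (trans (map-+-downFrom d (suc k′)) (cong (λ a → descent a (suc k′)) (sym (+-suc e c))))
                  (cong [_] (top-entry k′ e c)))
    occ≅τ : orderIsoᵇ occ τ ≡ true
    occ≅τ = subst (λ s → orderIsoᵇ s τ ≡ true) translate (orderIsoᵇ-map (_+_ d) (+-<ᵇ d) τ)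
    occ⊆π : occ ⊆ π
    occ⊆π = subst (occ ⊆_)
      (sym (trans (cong (_++ N ∷ w) (descent-++ (suc c) (suc k′) e)) (++-assoc (descent (e + suc c) (suc k′)) _ (N ∷ w))))
      (++⁺ ⊆-refl (++⁺ˡ (descent (suc c) e) (refl ∷ minimum w)))

  avoiderᵇ-false-if-distinct : ∀ π → (distinct π ≡ true → avoiderᵇ π ≡ false) → avoiderᵇ π ≡ false
  avoiderᵇ-false-if-distinct π not-avoider with distinct π
  ... | false = refl
  ... | true = not-avoider refl

  -- By counting, b and the maximum N occur after y, and they form a 123 or a 132 with it.
  avoiderᵇ-descent-small : ∀ b j y w → 1 ≤ y → y < b → length w ≡ b → All (_∈ range 1 (j + suc b)) w →
    avoiderᵇ (descent (suc b) j ++ y ∷ w) ≡ false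
  avoiderᵇ-descent-small b j y w 1≤y y<b ∣w∣≡b w⊆range = avoiderᵇ-false-if-distinct π distinct⇒contains
    where
    N = j + suc b
    π = descent (suc b) j ++ y ∷ w
    b<N : b < N
    b<N = m≤n+m (suc b) j
    y<N : y < N
    y<N = <-trans y<b b<N
    ≤N : ∀ {z} → z < N → z < N + 1
    ≤N z<N = <-≤-trans z<N (m≤m+n N 1)
    run⊆range : ∀ {z} → z ∈ descent (suc b) j → z ∈ range 1 N
    run⊆range z∈run = ∈-range⁺ (≤-trans (s≤s z≤n) (proj₁ (∈-descent⁻ z∈run))) (≤N (proj₂ (∈-descent⁻ z∈run)))
    π⊆range : All (_∈ range 1 N) π
    π⊆range = All.++⁺ (All.tabulate run⊆range) (∈-range⁺ 1≤y (≤N y<N) ∷ w⊆range)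
    ∣range∣≤∣π∣ : length (range 1 N) ≤ length π
    ∣range∣≤∣π∣ = ≤-reflexive (trans (length-range 1 N)
      (sym (trans (length-++ (descent (suc b) j)) (cong₂ _+_ (length-descent (suc b) j) (cong suc ∣w∣≡b)))))
    after-y : ∀ {z} → z ∈ π → z ∉ descent (suc b) j → z ≢ y → z ∈ w
    after-y z∈π z∉run z≢y with ∈-++⁻ (descent (suc b) j) z∈π
    ... | inj₁ z∈run = ⊥-elim (z∉run z∈run)
    ... | inj₂ (here z≡y) = ⊥-elim (z≢y z≡y)
    ... | inj₂ (there z∈w) = z∈w
    distinct⇒contains : distinct π ≡ true → avoiderᵇ π ≡ false
    distinct⇒contains d with pair-⊆ b∈w N∈w (<⇒≢ b<N)
      where
      b∈w = after-y (distinct-⊆-complete π (range 1 N) d π⊆range ∣range∣≤∣π∣ (∈-range⁺ (≤-trans 1≤y (<⇒≤ y<b)) (≤N b<N)))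
              (λ b∈run → <-irrefl refl (proj₁ (∈-descent⁻ b∈run))) (>⇒≢ y<b)
      N∈w = after-y (distinct-⊆-complete π (range 1 N) d π⊆range ∣range∣≤∣π∣ (∈-range⁺ (≤-trans (s≤s z≤n) b<N) (m<m+n N z<s)))
              (λ N∈run → <-irrefl refl (proj₂ (∈-descent⁻ N∈run))) (>⇒≢ y<N)
    ... | inj₁ bN⊆w = avoiderᵇ-contains π (here refl)
            (containsᵇ-⊆ (1 ∷ 2 ∷ 3 ∷ []) (++⁺ˡ (descent (suc b) j) (refl ∷ bN⊆w)) (orderIsoᵇ-123 y<b b<N))
    ... | inj₂ Nb⊆w = avoiderᵇ-contains π (there (here refl))
            (containsᵇ-⊆ (1 ∷ 3 ∷ 2 ∷ []) (++⁺ˡ (descent (suc b) j) (refl ∷ Nb⊆w)) (orderIsoᵇ-132 y<b b<N))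

  avoiderᵇ-descent-top-all≤ : ∀ b j w → j ≤ k′ → All (_∈ range 1 (j + suc b)) w →
    avoiderᵇ (descent (suc b) j ++ (j + suc b) ∷ w) ≡ all≤ᵇ b w ∧ avoiderᵇ w
  avoiderᵇ-descent-top-all≤ b j w j≤k′ w⊆range with all≤ᵇ b w in bounded
  ... | true = avoiderᵇ-descent-top j (suc b) (j + suc b) w j≤k′ ≤-refl
                 (All.map (λ {z} → <ᵇ-true⇒< z (suc b)) (all-true⁻ _ w bounded))
  ... | false with all-false⁻ _ w bounded
  ...   | z , z∈w , z≮1+b = subst (λ π → avoiderᵇ π ≡ false) (++-assoc (descent (suc b) j) [ N ] w)
                              (avoiderᵇ-duplicate (descent (suc b) j ++ [ N ]) w z∈run z∈w)
    where
    N = j + suc b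
    z∈run : z ∈ descent (suc b) j ++ [ N ]
    z∈run with z ≟ N
    ... | yes refl = ∈-++⁺ʳ (descent (suc b) j) (here refl)
    ... | no z≢N = ∈-++⁺ˡ (∈-descent⁺ (<ᵇ-false⇒≥ z (suc b) z≮1+b)
                     (≤∧≢⇒< (≤-pred (subst (z <_) (+-comm N 1) (proj₂ (∈-range⁻ (All.lookup w⊆range z∈w))))) z≢N))

  avoiders : ℕ → ℕ
  avoiders n = countAvoiders R (+ n)

  avoiders≡countᵇ-words : ∀ n → avoiders n ≡ countᵇ avoiderᵇ (words (range 1 n) n)
  avoiders≡countᵇ-words n =
    trans (length-filterᵇ (avoidsAllᵇ R) (Sn n))
          (trans (countᵇ-filterᵇ distinct (avoidsAllᵇ R) (words (oneTo n) n))
                 (cong (λ xs → countᵇ avoiderᵇ (words xs n)) (oneTo≡range n)))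

  completions : ℕ → ℕ → ℕ
  completions b j = countᵇ (λ w → avoiderᵇ (descent (suc b) j ++ w)) (words (range 1 (j + suc b)) (suc b))

  completionsWith : ℕ → ℕ → ℕ → ℕ
  completionsWith b j y = countᵇ (λ w → avoiderᵇ (descent (suc b) j ++ y ∷ w)) (words (range 1 (j + suc b)) b)

  completions-by-next : ∀ b j →
    completions b j ≡ sum (map (completionsWith b j) (range 1 (j + b))) + completionsWith b j (j + suc b)
  completions-by-next b j = begin
    completions b j                                                     ≡⟨ countᵇ-words-suc _ (range 1 (j + suc b)) b ⟩
    sum (map (completionsWith b j) (range 1 (j + suc b)))               ≡⟨ cong (sum ∘ map (completionsWith b j)) range-top ⟩
    sum (map (completionsWith b j) (range 1 (j + b) ++ [ j + suc b ]))  ≡⟨ cong sum (map-++ (completionsWith b j) (range 1 (j + b)) _) ⟩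
    sum (map (completionsWith b j) (range 1 (j + b)) ++ [ completionsWith b j (j + suc b) ])
      ≡⟨ sum-++ (map (completionsWith b j) (range 1 (j + b))) _ ⟩
    sum (map (completionsWith b j) (range 1 (j + b))) + (completionsWith b j (j + suc b) + 0)
      ≡⟨ cong (_+_ (sum (map (completionsWith b j) (range 1 (j + b))))) (+-identityʳ _) ⟩
    sum (map (completionsWith b j) (range 1 (j + b))) + completionsWith b j (j + suc b) ∎
    where
    open ≡-Reasoning
    range-top : range 1 (j + suc b) ≡ range 1 (j + b) ++ [ j + suc b ]
    range-top = trans (cong (range 1) (+-suc j b))
      (trans (range-∷ʳ 1 (j + b)) (cong (λ t → range 1 (j + b) ++ [ t ]) (trans (+-comm (j + b) 1) (sym (+-suc j b)))))

  completionsWith-top : ∀ b j → j ≤ k′ → completionsWith b j (j + suc b) ≡ avoiders b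
  completionsWith-top b j j≤k′ =
    trans (countᵇ-words-cong (range 1 (j + suc b)) b (λ w _ w⊆range → avoiderᵇ-descent-top-all≤ b j w j≤k′ w⊆range))
          (trans (countᵇ-words-all≤ avoiderᵇ b (j + suc b) b (≤-trans (n≤1+n b) (m≤n+m (suc b) j)))
                 (sym (avoiders≡countᵇ-words b)))

  completionsWith-top-long : ∀ b j → k′ < j → completionsWith b j (j + suc b) ≡ 0
  completionsWith-top-long b j k′<j = countᵇ-words-false _ b (λ w _ _ → avoiderᵇ-long-descent-top b j w k′<j)

  completionsWith-repeat : ∀ b j y → y ∈ descent (suc b) j → completionsWith b j y ≡ 0
  completionsWith-repeat b j y y∈run =
    countᵇ-false (words (range 1 (j + suc b)) b) (λ w → avoiderᵇ-duplicate (descent (suc b) j) (y ∷ w) y∈run (here refl))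

  sum-completionsWith-below-top-zero : ∀ j → sum (map (completionsWith 0 j) (range 1 (j + 0))) ≡ 0
  sum-completionsWith-below-top-zero j = sum-range-zero (completionsWith 0 j) 1 (j + 0)
    (λ y 1≤y y<j+1 → completionsWith-repeat 0 j y (∈-descent⁺ 1≤y (subst (λ t → y < t + 1) (+-identityʳ j) y<j+1)))

  -- Below the maximum, only the letter b + 1, which continues the run, can lead to an avoider.
  sum-completionsWith-below-top-suc : ∀ b j → sum (map (completionsWith (suc b) j) (range 1 (j + suc b))) ≡ completions b (suc j)
  sum-completionsWith-below-top-suc b j =
    trans (sum-range-single (completionsWith (suc b) j) 1 (j + suc b) (suc b) (s≤s z≤n) (1+b<N+1) other)
          continue-run
    where
    1+b<N+1 : suc b < j + suc b + 1
    1+b<N+1 = subst (suc b <_) (+-comm 1 (j + suc b)) (s≤s (m≤n+m (suc b) j))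
    other : ∀ y → 1 ≤ y → y < j + suc b + 1 → y ≢ suc b → completionsWith (suc b) j y ≡ 0
    other y 1≤y y<N+1 y≢1+b with <-cmp y (suc b)
    ... | tri< y<1+b _ _ = countᵇ-words-false _ (suc b) (λ w ∣w∣≡ w⊆range → avoiderᵇ-descent-small (suc b) j y w 1≤y y<1+b ∣w∣≡ w⊆range)
    ... | tri≈ _ y≡1+b _ = ⊥-elim (y≢1+b y≡1+b)
    ... | tri> _ _ 1+b<y = completionsWith-repeat (suc b) j y
            (∈-descent⁺ 1+b<y (subst (y <_) (trans (+-comm (j + suc b) 1) (sym (+-suc j (suc b)))) y<N+1))
    continue-run : completionsWith (suc b) j (suc b) ≡ completions b (suc j)
    continue-run = trans
      (countᵇ-cong (words (range 1 (j + suc (suc b))) (suc b))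
        (λ w → cong avoiderᵇ (trans (sym (++-assoc (descent (suc (suc b)) j) [ suc b ] w)) (cong (_++ w) (descent-∷ʳ (suc b) j)))))
      (cong (λ t → countᵇ (λ w → avoiderᵇ (descent (suc b) (suc j) ++ w)) (words (range 1 t) (suc b))) (+-suc j (suc b)))

  completions-closed : ∀ b j → completions b j ≡ sum (take (suc k′ ∸ j) (history avoiders b))
  completions-closed zero j with j ≤? k′
  ... | yes j≤k′ rewrite completions-by-next 0 j | sum-completionsWith-below-top-zero j
                       | completionsWith-top 0 j j≤k′ | +-∸-assoc 1 j≤k′ | sum-take-[0] (k′ ∸ j) = refl
  ... | no j≰k′ rewrite completions-by-next 0 j | sum-completionsWith-below-top-zero j
                      | completionsWith-top-long 0 j (≰⇒> j≰k′) | m≤n⇒m∸n≡0 (≰⇒> j≰k′) = refl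
  completions-closed (suc b) j with j ≤? k′
  ... | yes j≤k′ rewrite completions-by-next (suc b) j | sum-completionsWith-below-top-suc b j
                       | completions-closed b (suc j) | completionsWith-top (suc b) j j≤k′ | +-∸-assoc 1 j≤k′ =
    +-comm (sum (take (k′ ∸ j) (history avoiders b))) (avoiders (suc b))
  ... | no j≰k′ rewrite completions-by-next (suc b) j | sum-completionsWith-below-top-suc b j
                      | completions-closed b (suc j) | completionsWith-top-long (suc b) j (≰⇒> j≰k′)
                      | m≤n⇒m∸n≡0 (≰⇒> j≰k′) | m≤n⇒m∸n≡0 (<⇒≤ (≰⇒> j≰k′)) = refl

  avoiders-recurrence : ∀ n → avoiders (suc n) ≡ sum (take (suc k′) (history avoiders n))
  avoiders-recurrence n = trans (avoiders≡countᵇ-words (suc n)) (completions-closed n 0)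

theorem3p12 : (k : ℕ) → 2 ≤ k →
    ((n : ℤ) → countAvoiders ((1 ∷ 2 ∷ 3 ∷ []) ∷ (1 ∷ 3 ∷ 2 ∷ []) ∷ decThenMax k ∷ []) n
                 ≡ F (k Data.Nat.∸ 1) (n Data.Integer.+ + 1))
    × ((n : ℕ) → ((λ m → + countAvoiders ((1 ∷ 2 ∷ 3 ∷ []) ∷ (1 ∷ 3 ∷ 2 ∷ []) ∷ decThenMax k ∷ []) (+ m)) ⊛ denom k) n
                 ≡ oneS n)
theorem3p12 (suc (suc k′)) (s≤s (s≤s z≤n)) = counts , generatingFunction
  where
  open Avoidance k′
  open Recurrence (suc k′) avoiders refl avoiders-recurrence
  counts : (n : ℤ) → countAvoiders R n ≡ F (suc k′) (n ℤ.+ + 1)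
  counts (+ n) = trans (sym (F≡a n)) (cong (F (suc k′) ∘ +_) (+-comm 1 n))
  counts -[1+ zero ] = refl
  counts -[1+ suc _ ] = refl
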